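{- Let $(A,B)$ be an instance of 3-Partition and let $\Phi(A,B)=(S,\mathrm{val},\mathcal{E},C)$ be the OCP instance constructed from it as described in the context. If there exists an ordered covering $\mathcal{E}'$ of $\Phi(A,B)$ with $F(\mathcal{E}')\le C$, then $(A,B)$ is a YES instance of 3-Partition.
   Context: OCP: an instance consists of a finite label set $S$, a family $\mathcal{E}$ of finite sets with $S\subseteq\bigcup\mathcal{E}$, a weight function $\mathrm{val}$ assigning a positive integer to every element of $\bigcup\mathcal{E}$, and a budget $C\in\mathbb{N}$. An ordered covering is a tuple $\mathcal{E}'=(E'_1,\dots,E'_k)$ of members of $\mathcal{E}$ with $S\subseteq\bigcup_i E'_i$; its residual sets are $U_i=E'_i\setminus\bigcup_{j<i}E'_j$, residual weights $u_i=\sum_{x\in U_i}\mathrm{val}(x)$, partial costs $f(E'_i)=2^{u_i}$ if $u_i>0$ and $0$ if $u_i=0$, and total cost $F(\mathcal{E}')=\sum_i f(E'_i)$. 3-Partition: an instance is a multiset $A=\{a_1,\dots,a_{3m}\}$ of positive integers and a positive integer $B$ with $\sum_{i=1}^{3m}a_i=mB$ and $B/4<a_i<B/2$ for all $i$; it is a YES instance if the elements of $A$ (distinguished by index) can be partitioned into $m$ triplets each of sum $B$. The construction $\Phi(A,B)$: let $S=\{\alpha_1,\dots,\alpha_{3m}\}$ with $\mathrm{val}(\alpha_\ell)=a_\ell$ (distinct labels even for repeated values). Let $T$ be the collection of all 3-element subsets $X\subseteq S$ with $\sum_{\alpha\in X}\mathrm{val}(\alpha)=B$, enumerated as $X_1,\dots,X_{|T|}$.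 Set $t=1$ and $w=t+B+\lceil\log_2 m\rceil+1$. For each $i\in\{1,\dots,m\}$ and $j\in\{1,\dots,|T|\}$ introduce two new distinct elements $\omega_{ij},\tau_{ij}\notin S$ (all distinct across pairs $(i,j)$) with $\mathrm{val}(\omega_{ij})=w$ and $\mathrm{val}(\tau_{ij})=t$, and define the opening edge $A_{ij}=\{\omega_{ij}\}$ and the assignment edge $E_{ij}=X_j\cup\{\omega_{ij},\tau_{ij}\}$. Let $\mathcal{E}=\{A_{ij},E_{ij}: i\in\{1,\dots,m\}, j\in\{1,\dots,|T|\}\}$ and $C=m(2^w+2^{t+B})$. -}

module Defs where

open import Data.Nat using (ℕ; zero; suc; _+_; _*_; _^_; _<_)
open import Data.Nat.Logarithm using (⌈log₂_⌉)
open import Data.Nat.ListAction using (sum)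
open import Data.Fin using (Fin)
import Data.Fin as F
open import Data.Fin.Properties using (_≟_)
open import Data.Bool using (Bool; true; false; _∧_; _∨_; not; if_then_else_)
open import Data.List using (List; []; _∷_; map; filter; _++_; allFin)
open import Data.Bool.ListAction using (any)
open import Data.Bool using (T?)
open import Data.List.Relation.Unary.Any using (Any)
open import Data.List.Membership.Propositional using (_∈_)
open import Data.Product using (Σ; _×_; _,_; ∃)
open import Relation.Nullary.Decidable using (⌊_⌋)
open import Relation.Binary.PropositionalEquality using (_≡_)
open import Data.Unit using (⊤)
open import Data.Empty using (⊥)
open import Function.Bundles using (_⤖_; Bijection)

record Is3PartitionInstance (m : ℕ) (a : Fin (3 * m) → ℕ) (B : ℕ) : Set where
  field
    B-pos    : 0 < B
    a-pos    : ∀ ℓ → 0 < a ℓ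
    sum≡mB   : sum (map a (allFin (3 * m))) ≡ m * B
    quarter< : ∀ ℓ → B < 4 * a ℓ
    <half    : ∀ ℓ → 2 * a ℓ < B

-- YES instance: the indices can be partitioned into m triplets each of
-- sum B, i.e. there is a bijection Fin m × Fin 3 ≅ Fin (3m) (triplet i
-- consists of the images of (i,0),(i,1),(i,2)) with every triplet summing to B.
IsYes3Partition : (m : ℕ) (a : Fin (3 * m) → ℕ) (B : ℕ) → Set
IsYes3Partition m a B =
  ∃ λ (σ : (Fin m × Fin 3) ⤖ Fin (3 * m)) →
    let g = Bijection.to σ in
    ∀ i → a (g (i , F.zero)) + a (g (i , F.suc F.zero)) + a (g (i , F.suc (F.suc F.zero))) ≡ B

module OCP {Elem Edge : Set} (eqE : Elem → Elem → Bool)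
           (members : Edge → List Elem) (val : Elem → ℕ) where

  memberB : Elem → List Elem → Bool
  memberB x xs = any (eqE x) xs

  f : ℕ → ℕ
  f zero    = 0
  f (suc u) = 2 ^ suc u

  residualWeight : List Elem → Edge → ℕ
  residualWeight seen e =
    sum (map val (filter (λ x → T? (not (memberB x seen))) (members e)))

  costFrom : List Elem → List Edge → ℕ
  costFrom seen []       = 0
  costFrom seen (e ∷ es) = f (residualWeight seen e) + costFrom (seen ++ members e) es

  F-cost : List Edge → ℕ
  F-cost = costFrom []

  IsOrderedCovering : (Elem → Set) → List Edge → Set
  IsOrderedCovering inS es = ∀ x → inS x → Any (λ e → x ∈ members e) es

Triple : ℕ → Set
Triple n = Fin n × Fin n × Fin n

-- X = {α_x, α_y, α_z} ∈ T, listed canonically with x < y < z.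
InT : {n : ℕ} → (Fin n → ℕ) → ℕ → Triple n → Set
InT a B (x , y , z) = (x F.< y) × (y F.< z) × (a x + a y + a z ≡ B)

data Elem (n m : ℕ) : Set where
  α : Fin n → Elem n m
  ω : Fin m → Triple n → Elem n m
  τ : Fin m → Triple n → Elem n m

module Phi (m : ℕ) (a : Fin (3 * m) → ℕ) (B : ℕ) where

  n : ℕ
  n = 3 * m

  TT : Set
  TT = Σ (Triple n) (InT a B)

  data Edge : Set where
    A-edge : Fin m → TT → Edge
    E-edge : Fin m → TT → Edge

  members : Edge → List (Elem n m)
  members (A-edge i (X , _))           = ω i X ∷ []
  members (E-edge i ((x , y , z) , _)) =
    α x ∷ α y ∷ α z ∷ ω i (x , y , z) ∷ τ i (x , y , z) ∷ []

  eqF : {k : ℕ} → Fin k → Fin k → Bool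
  eqF p q = ⌊ p ≟ q ⌋

  eqT : Triple n → Triple n → Bool
  eqT (x , y , z) (x′ , y′ , z′) = eqF x x′ ∧ eqF y y′ ∧ eqF z z′

  eqE : Elem n m → Elem n m → Bool
  eqE (α x)   (α y)     = eqF x y
  eqE (ω i X) (ω j Y)   = eqF i j ∧ eqT X Y
  eqE (τ i X) (τ j Y)   = eqF i j ∧ eqT X Y
  eqE _       _         = false

  t : ℕ
  t = 1

  w : ℕ
  w = t + B + ⌈log₂ m ⌉ + 1

  val : Elem n m → ℕ
  val (α ℓ)   = a ℓ
  val (ω _ _) = w
  val (τ _ _) = t

  C : ℕ
  C = m * (2 ^ w + 2 ^ (t + B))

  InS : Elem n m → Set
  InS (α _) = ⊤
  InS _     = ⊥

  open OCP {Elem n m} {Edge} eqE members val public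

-- Whenever the opening element ω_{iX} of an edge is covered for the first time, that edge pays
-- at least 2^w, and m·2^(t+B) < 2^w by the choice of w; so a covering of cost at most
-- C = m(2^w + 2^(t+B)) has at most m such openings. Every label α_ℓ lies in some E_{iX}, and the
-- edge that opened ω_{iX} carries the same triple X; hence the triples of the (at most m) openings
-- cover all 3m labels, so there are exactly m of them, they are disjoint, and each sums to B.
module Submission where

open import Defs
open import Data.Nat using (ℕ; zero; suc; _+_; _*_; _^_; _≤_; _<_; z≤n; s≤s; s≤s⁻¹; NonZero; ⌈_/2⌉; ⌊_/2⌋)
open import Data.Nat.Properties hiding (_≟_)
open import Data.Nat.ListAction using (sum)
open import Data.Nat.Logarithm using (⌈log₂_⌉)
open import Data.Nat.Logarithm.Core using (⌈log2⌉)
open import Data.Nat.Induction using (<-wellFounded)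
open import Induction.WellFounded using (Acc; acc)
open import Data.Fin using (Fin; zero; suc; punchIn; punchOut; combine; remQuot; _≟_)
open import Data.Fin.Properties using (punchIn-punchOut; remQuot-combine; injective⇒≤)
open import Data.Bool using (Bool; true; false; not; if_then_else_; T)
open import Data.Bool.Properties using (T-∧)
open import Data.List using (List; []; _∷_; _++_; length; lookup)
open import Data.List.Relation.Unary.Any using (Any; here; there; index)
import Data.List.Relation.Unary.Any as Any
open import Data.List.Relation.Unary.Any.Properties using (any⁻; lookup-index)
open import Data.List.Membership.Propositional using (_∈_; find)
open import Data.List.Membership.Propositional.Properties using (∈-++⁻; ∈-map⁺; ∈-filter⁺)
open import Data.List.Relation.Binary.Subset.Propositional using (_⊆_)
open import Data.List.Relation.Binary.Subset.Propositional.Properties using (Any-resp-⊆)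
open import Data.Product using (Σ; _×_; _,_; ∃; proj₁; proj₂)
open import Data.Sum using (_⊎_; inj₁; inj₂)
open import Data.Unit using (tt)
open import Function using (_∘_; id; Equivalence)
open import Function.Definitions using (Injective; StrictlySurjective)
open import Function.Bundles using (mk⤖)
open import Function.Consequences.Propositional using (strictlySurjective⇒surjective)
open import Relation.Binary.PropositionalEquality using (_≡_; refl; sym; trans; cong; cong₂; subst)
open import Relation.Nullary using (yes; no; contradiction)
open import Relation.Nullary.Decidable using (toWitness)

surjective⇒≤ : ∀ {n m} {f : Fin n → Fin m} → StrictlySurjective _≡_ f → m ≤ n
surjective⇒≤ {f = f} surj = injective⇒≤ section-injective
  where
  section-injective : Injective _≡_ _≡_ (proj₁ ∘ surj)
  section-injective {x} {y} eq = trans (sym (proj₂ (surj x))) (trans (cong f eq) (proj₂ (surj y)))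

surjective⇒injective : ∀ {n m} {f : Fin n → Fin m} → n ≤ m → StrictlySurjective _≡_ f → Injective _≡_ _≡_ f
surjective⇒injective {zero} _ _ {()}
surjective⇒injective {suc n} {f = f} n<m surj {i} {j} fi≡fj with i ≟ j
... | yes i≡j = i≡j
... | no i≢j = contradiction (surjective⇒≤ {f = f ∘ punchIn i} skip-i) (<⇒≱ n<m)
  where
  -- f i is also hit by j, so f stays surjective on the complement of i
  avoid-i : ∀ x → ∃ λ x′ → f (punchIn i x′) ≡ f x
  avoid-i x with i ≟ x
  ... | yes refl = punchOut i≢j , trans (cong f (punchIn-punchOut i≢j)) (sym fi≡fj)
  ... | no i≢x = punchOut i≢x , cong f (punchIn-punchOut i≢x)

  skip-i : StrictlySurjective _≡_ (f ∘ punchIn i)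
  skip-i y = let x , fx≡y = surj y ; x′ , fx′≡fx = avoid-i x in x′ , trans fx′≡fx fx≡y

module _ {k m c : ℕ} {g : Fin k × Fin c → Fin (c * m)} (g-surj : StrictlySurjective _≡_ g) where
  private
    g′ : Fin (k * c) → Fin (c * m)
    g′ = g ∘ remQuot c

    g′-surj : StrictlySurjective _≡_ g′
    g′-surj y = let (i , j) , gij≡y = g-surj y in combine i j , trans (cong g (remQuot-combine i j)) gij≡y

  grouped-surjective⇒≥ : .{{NonZero c}} → m ≤ k
  grouped-surjective⇒≥ = *-cancelˡ-≤ c (≤-trans (surjective⇒≤ g′-surj) (≤-reflexive (*-comm k c)))

  grouped-surjective⇒injective : k ≤ m → Injective _≡_ _≡_ g
  grouped-surjective⇒injective k≤m {i , j} {i′ , j′} eq =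
    trans (sym (remQuot-combine i j)) (trans (cong (remQuot c) (g′-injective g′-eq)) (remQuot-combine i′ j′))
    where
    g′-injective : Injective _≡_ _≡_ g′
    g′-injective = surjective⇒injective (≤-trans (*-monoˡ-≤ c k≤m) (≤-reflexive (*-comm m c))) g′-surj

    g′-eq : g′ (combine i j) ≡ g′ (combine i′ j′)
    g′-eq = trans (cong g (remQuot-combine i j)) (trans eq (sym (cong g (remQuot-combine i′ j′))))

n≤2*⌈n/2⌉ : ∀ n → n ≤ 2 * ⌈ n /2⌉
n≤2*⌈n/2⌉ n = begin
  n                     ≡⟨ sym (⌊n/2⌋+⌈n/2⌉≡n n) ⟩
  ⌊ n /2⌋ + ⌈ n /2⌉     ≤⟨ +-monoˡ-≤ ⌈ n /2⌉ (⌊n/2⌋≤⌈n/2⌉ n) ⟩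
  ⌈ n /2⌉ + ⌈ n /2⌉     ≡⟨ cong (⌈ n /2⌉ +_) (sym (+-identityʳ ⌈ n /2⌉)) ⟩
  2 * ⌈ n /2⌉           ∎
  where open ≤-Reasoning

n≤2^⌈log2⌉n : ∀ n (rec : Acc _<_ n) → n ≤ 2 ^ ⌈log2⌉ n rec
n≤2^⌈log2⌉n zero _ = z≤n
n≤2^⌈log2⌉n (suc zero) _ = s≤s z≤n
n≤2^⌈log2⌉n (suc (suc n)) (acc rs) = begin
  2 + n                 ≤⟨ +-monoʳ-≤ 2 (n≤2*⌈n/2⌉ n) ⟩
  2 + 2 * ⌈ n /2⌉       ≡⟨ sym (*-suc 2 ⌈ n /2⌉) ⟩
  2 * suc ⌈ n /2⌉       ≤⟨ *-monoʳ-≤ 2 (n≤2^⌈log2⌉n (suc ⌈ n /2⌉) _) ⟩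
  2 * 2 ^ ⌈log2⌉ (suc ⌈ n /2⌉) (rs (⌈n/2⌉<n n)) ∎
  where open ≤-Reasoning

n≤2^⌈log₂n⌉ : ∀ n → n ≤ 2 ^ ⌈log₂ n ⌉
n≤2^⌈log₂n⌉ n = n≤2^⌈log2⌉n n (<-wellFounded n)

m*2^e<2^[e+⌈log₂m⌉+1] : ∀ m e → m * 2 ^ e < 2 ^ (e + ⌈log₂ m ⌉ + 1)
m*2^e<2^[e+⌈log₂m⌉+1] m e = begin-strict
  m * 2 ^ e                 ≤⟨ *-monoˡ-≤ (2 ^ e) (n≤2^⌈log₂n⌉ m) ⟩
  2 ^ ⌈log₂ m ⌉ * 2 ^ e     ≡⟨ *-comm (2 ^ ⌈log₂ m ⌉) (2 ^ e) ⟩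
  2 ^ e * 2 ^ ⌈log₂ m ⌉     ≡⟨ sym (^-distribˡ-+-* 2 e ⌈log₂ m ⌉) ⟩
  2 ^ (e + ⌈log₂ m ⌉)       <⟨ ^-monoʳ-< 2 (s≤s (s≤s z≤n)) (m<m+n (e + ⌈log₂ m ⌉) (s≤s z≤n)) ⟩
  2 ^ (e + ⌈log₂ m ⌉ + 1)   ∎
  where open ≤-Reasoning

∈⇒≤sum : ∀ {n ns} → n ∈ ns → n ≤ sum ns
∈⇒≤sum {ns = n ∷ ns} (here refl) = m≤m+n n (sum ns)
∈⇒≤sum {ns = n ∷ ns} (there k∈ns) = ≤-trans (∈⇒≤sum k∈ns) (m≤n+m (sum ns) n)

module Openings {Elem Edge : Set} (eqE : Elem → Elem → Bool) (members : Edge → List Elem) (val : Elem → ℕ)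
  (eqE-sound : ∀ {x y} → T (eqE x y) → x ≡ y)
  (key : Edge → Elem) (key∈members : ∀ e → key e ∈ members e)
  (key-private : ∀ {e e′} → key e ∈ members e′ → key e′ ≡ key e)
  where
  open OCP eqE members val

  memberB-sound : ∀ {x xs} → T (memberB x xs) → x ∈ xs
  memberB-sound {x} {xs} = Any.map eqE-sound ∘ any⁻ (eqE x) xs

  openings : List Elem → List Edge → List Edge
  openings seen [] = []
  openings seen (e ∷ es) =
    if memberB (key e) seen then openings (seen ++ members e) es else e ∷ openings (seen ++ members e) es

  fresh-key≤residualWeight : ∀ seen e → memberB (key e) seen ≡ false → val (key e) ≤ residualWeight seen e
  fresh-key≤residualWeight seen e fresh =
    ∈⇒≤sum (∈-map⁺ val (∈-filter⁺ _ (key∈members e) (subst (T ∘ not) (sym fresh) tt)))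

  2^≤f : ∀ {v u} → 0 < v → v ≤ u → 2 ^ v ≤ f u
  2^≤f {u = zero} (s≤s _) ()
  2^≤f {u = suc u} _ v≤u = ^-monoʳ-≤ 2 v≤u

  openings-cost : ∀ {w} → 0 < w → (∀ e → w ≤ val (key e)) →
                  ∀ seen es → length (openings seen es) * 2 ^ w ≤ costFrom seen es
  openings-cost 0<w heavy seen [] = z≤n
  openings-cost 0<w heavy seen (e ∷ es) with memberB (key e) seen in covered
  ... | true = ≤-trans (openings-cost 0<w heavy _ es) (m≤n+m _ _)
  ... | false = +-mono-≤ (2^≤f 0<w (≤-trans (heavy e) (fresh-key≤residualWeight seen e covered)))
                         (openings-cost 0<w heavy _ es)

  head-opening : ∀ seen e es → key e ∈ seen ⊎ e ∈ openings seen (e ∷ es)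
  head-opening seen e es with memberB (key e) seen in covered
  ... | true = inj₁ (memberB-sound (subst T (sym covered) tt))
  ... | false = inj₂ (here refl)

  tail-openings : ∀ seen e es → openings (seen ++ members e) es ⊆ openings seen (e ∷ es)
  tail-openings seen e es with memberB (key e) seen
  ... | true = id
  ... | false = there

  openings-complete : ∀ seen {e} es → e ∈ es → key e ∈ seen ⊎ Any (λ e′ → key e′ ≡ key e) (openings seen es)
  openings-complete seen (e ∷ es) (here refl) with head-opening seen e es
  ... | inj₁ covered = inj₁ covered
  ... | inj₂ opening = inj₂ (Any.map (λ { refl → refl }) opening)
  openings-complete seen (e′ ∷ es) (there e∈es) with openings-complete (seen ++ members e′) es e∈es
  ... | inj₂ opened = inj₂ (Any-resp-⊆ (tail-openings seen e′ es) opened)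
  ... | inj₁ covered with ∈-++⁻ seen covered
  ...   | inj₁ key∈seen = inj₁ key∈seen
  ...   | inj₂ key∈e′ with head-opening seen e′ es
  ...     | inj₁ key′∈seen = inj₁ (subst (_∈ seen) (key-private key∈e′) key′∈seen)
  ...     | inj₂ opening = inj₂ (Any.map (λ { refl → key-private key∈e′ }) opening)

  opened-by-openings : ∀ {e es} → e ∈ es → Any (λ e′ → key e′ ≡ key e) (openings [] es)
  opened-by-openings {es = es} e∈es with openings-complete [] es e∈es
  ... | inj₁ ()
  ... | inj₂ opened = opened

module Construction (m : ℕ) (a : Fin (3 * m) → ℕ) (B : ℕ) where
  open Phi m a B

  eqT-sound : ∀ {X Y} → T (eqT X Y) → X ≡ Y
  eqT-sound {x , y , z} {x′ , y′ , z′} h =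
    let x≡x′ , h′ = Equivalence.to (T-∧ {eqF x x′}) h ; y≡y′ , z≡z′ = Equivalence.to (T-∧ {eqF y y′}) h′
    in cong₂ _,_ (toWitness x≡x′) (cong₂ _,_ (toWitness y≡y′) (toWitness z≡z′))

  eqE-sound : ∀ {x y} → T (eqE x y) → x ≡ y
  eqE-sound {α x} {α y} h = cong α (toWitness h)
  eqE-sound {ω i X} {ω j Y} h = let i≡j , X≡Y = Equivalence.to (T-∧ {eqF i j}) h in cong₂ ω (toWitness i≡j) (eqT-sound X≡Y)
  eqE-sound {τ i X} {τ j Y} h = let i≡j , X≡Y = Equivalence.to (T-∧ {eqF i j}) h in cong₂ τ (toWitness i≡j) (eqT-sound X≡Y)
  eqE-sound {α _} {ω _ _} ()
  eqE-sound {α _} {τ _ _} ()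
  eqE-sound {ω _ _} {α _} ()
  eqE-sound {ω _ _} {τ _ _} ()
  eqE-sound {τ _ _} {α _} ()
  eqE-sound {τ _ _} {ω _ _} ()

  slot : Edge → Fin m
  slot (A-edge i _) = i
  slot (E-edge i _) = i

  triple : Edge → TT
  triple (A-edge _ X) = X
  triple (E-edge _ X) = X

  ω-of : Edge → Elem n m
  ω-of e = ω (slot e) (proj₁ (triple e))

  ω-of∈members : ∀ e → ω-of e ∈ members e
  ω-of∈members (A-edge _ _) = here refl
  ω-of∈members (E-edge _ _) = there (there (there (here refl)))

  ω∈members⇒ω-of : ∀ {i X} e → ω i X ∈ members e → ω-of e ≡ ω i X
  ω∈members⇒ω-of (A-edge _ _) (here eq) = sym eq
  ω∈members⇒ω-of (E-edge _ _) (there (there (there (here eq)))) = sym eq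
  ω∈members⇒ω-of (E-edge _ _) (there (there (there (there (there ())))))

  ω-injectiveʳ : ∀ {i j : Fin m} {X Y : Triple n} → Elem.ω {n} i X ≡ ω j Y → X ≡ Y
  ω-injectiveʳ refl = refl

  component : Triple n → Fin 3 → Fin n
  component (x , _ , _) zero = x
  component (_ , y , _) (suc zero) = y
  component (_ , _ , z) (suc (suc zero)) = z

  α∈members⇒component : ∀ {ℓ} e → α ℓ ∈ members e → ∃ λ c → component (proj₁ (triple e)) c ≡ ℓ
  α∈members⇒component (A-edge _ _) (there ())
  α∈members⇒component (E-edge _ _) (here refl) = zero , refl
  α∈members⇒component (E-edge _ _) (there (here refl)) = suc zero , refl
  α∈members⇒component (E-edge _ _) (there (there (here refl))) = suc (suc zero) , refl
  α∈members⇒component (E-edge _ _) (there (there (there (there (there ())))))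

  open Openings eqE members val eqE-sound ω-of ω-of∈members (λ {_} {e′} → ω∈members⇒ω-of e′) public

  cheap⇒few-openings : ∀ E′ → F-cost E′ ≤ C → length (openings [] E′) ≤ m
  cheap⇒few-openings E′ cheap = s≤s⁻¹ (*-cancelʳ-< (2 ^ w) k (suc m) (begin-strict
    k * 2 ^ w                        ≤⟨ ≤-trans (openings-cost 0<w (λ _ → ≤-refl) [] E′) cheap ⟩
    m * (2 ^ w + 2 ^ (t + B))        ≡⟨ *-distribˡ-+ m (2 ^ w) (2 ^ (t + B)) ⟩
    m * 2 ^ w + m * 2 ^ (t + B)      <⟨ +-monoʳ-< (m * 2 ^ w) (m*2^e<2^[e+⌈log₂m⌉+1] m (t + B)) ⟩
    m * 2 ^ w + 2 ^ w                ≡⟨ +-comm (m * 2 ^ w) (2 ^ w) ⟩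
    suc m * 2 ^ w                    ∎))
    where
    open ≤-Reasoning
    k = length (openings [] E′)
    0<w : 0 < w
    0<w = m≤n+m 1 (t + B + ⌈log₂ m ⌉)

  labels : ∀ {k} → (Fin k → TT) → Fin k × Fin 3 → Fin n
  labels Q (i , c) = component (proj₁ (Q i)) c

  covering⇒labels-surjective : ∀ {E′} → IsOrderedCovering InS E′ →
                               StrictlySurjective _≡_ (labels (triple ∘ lookup (openings [] E′)))
  covering⇒labels-surjective covering ℓ
    with e , e∈E′ , αℓ∈e ← find (covering (α ℓ) tt)
    with c , cth≡ℓ ← α∈members⇒component e αℓ∈e
    = let opened = opened-by-openings e∈E′
      in (index opened , c) , trans (cong (λ X → component X c) (ω-injectiveʳ (lookup-index opened))) cth≡ℓ

  labels-surjective⇒yes : ∀ {k} (Q : Fin k → TT) → k ≤ m → StrictlySurjective _≡_ (labels Q) → IsYes3Partition m a B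
  labels-surjective⇒yes Q k≤m surj with refl ← ≤-antisym k≤m (grouped-surjective⇒≥ surj) =
    mk⤖ (grouped-surjective⇒injective surj k≤m , strictlySurjective⇒surjective surj) , λ i → proj₂ (proj₂ (proj₂ (Q i)))

theorem4 : (m : ℕ) (a : Fin (3 * m) → ℕ) (B : ℕ)
    → Is3PartitionInstance m a B
    → Σ (List (Phi.Edge m a B)) (λ E′ → Phi.IsOrderedCovering m a B (Phi.InS m a B) E′ × Phi.F-cost m a B E′ ≤ Phi.C m a B)
    → IsYes3Partition m a B
theorem4 m a B _ (E′ , covering , cheap) =
  labels-surjective⇒yes (triple ∘ lookup (openings [] E′)) (cheap⇒few-openings E′ cheap) (covering⇒labels-surjective covering)
  where open Construction m a B
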